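{- Let $p,q\in\mathbb{Z}$, let $(G_n)_{n\ge0}$ be defined by $G_0=0$, $G_1=1$ and $G_n=pG_{n-1}+qG_{n-2}$ for $n\ge2$, let $r=p^2+4q\neq0$, and let $s$ be a positive integer. If either $p$ is odd, $\gcd(p,q)=1$ and $s^2\mid r$, or $p$ is even, $\gcd(p/2,q)=1$ and $s^2\mid r/4$, then for all integers $k,n\ge0$: $s^k\mid n$ if and only if $s^k\mid G_n$.
   Context: For integers $a,b$, $a\mid b$ means there is an integer $c$ with $b=ca$ (in particular $0\mid 0$); $\gcd$ denotes the greatest common divisor. -}

module Defs where

open import Data.Nat using (ℕ; zero; suc)
open import Data.Integer using (ℤ; +_; _+_; _*_; _^_)

G : ℤ → ℤ → ℕ → ℤ
G p q zero = + 0
G p q (suc zero) = + 1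
G p q (suc (suc n)) = p * G p q (suc n) + q * G p q n

module Submission where

-- Even case p = 2m.  Put d = m² + q and α = m + √d ∈ ℤ[√d].  The roots
-- of x² - 2mx - q are m ± √d, so G_n is the √d-coefficient Y_n of
-- α^n = X_n + Y_n √d.  Assume m ⊥ q and s² ∣ d (so s ⊥ m, s ⊥ q).
-- Reducing the binomial expansion of (a + √e)^n modulo D ∣ e gives
--   * Y_{j+1} ≡ (j+1)·m^j (mod s), hence s ∣ Y_n implies s ∣ n;
--   * α^{sn} = (X_n + Y_n √d)^s has √d-coefficient Y_n·W with
--     W ≡ s·X_n^{s-1} (mod s²), hence Y_{sn} = s·w·Y_n with w ⊥ s,
--     because the norm identity X_n² - d·Y_n² = (-q)^n makes X_n ⊥ s.
-- Induction on k then yields s^k ∣ n ⇔ s^k ∣ Y_n.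
-- Odd case: the parameters (2p, 4q) satisfy the even-case hypotheses,
-- G(2p, 4q, n) = 2^(n-1)·G(p, q, n), and s is odd as s² ∣ p² + 4q.

open import Defs
open import Data.Nat using (ℕ)
open import Data.Integer using (ℤ; +_; _+_; _*_; _^_; _>_)
open import Data.Integer.Divisibility using (_∣_)
open import Data.Integer.GCD using (gcd)
open import Data.Product using (_×_; ∃-syntax)
open import Data.Sum using (_⊎_)
open import Relation.Binary.PropositionalEquality using (_≡_; _≢_)
open import Function.Bundles using (_⇔_)

open import Data.Nat using (zero; suc; _∸_)
import Data.Nat as ℕ
import Data.Nat.Divisibility as ℕ
import Data.Nat.Coprimality as ℕ
open import Data.Integer using (-_; _-_; -[1+_]; +<+; NonZero)
import Data.Integer.Properties as ℤ
open import Data.Integer.Coprimality using (Coprime; coprime-divisor)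
  renaming (sym to coprime-sym)
open import Data.Integer.Divisibility.Signed
  using (divides; ∣ᵤ⇒∣; ∣⇒∣ᵤ; ∣-refl; ∣-trans; ∣m∣n⇒∣m+n; ∣m∣n⇒∣m-n; ∣m⇒∣m*n; ∣n⇒∣m*n;
         *-monoʳ-∣; *-cancelˡ-∣)
  renaming (_∣_ to _∣ˢ_)
open import Data.Integer.Tactic.RingSolver using (solve-∀)
open import Data.Product using (_,_; Σ)
open import Data.Sum using (inj₁; inj₂)
open import Function.Base using (_∘_)
open import Function.Bundles using (mk⇔; Equivalence)
open import Function.Construct.Symmetry using (⇔-sym)
open import Function.Related.Propositional using (module EquationalReasoning)
open import Relation.Binary.PropositionalEquality
  using (refl; sym; trans; cong; cong₂; subst; module ≡-Reasoning)

∣-resp : ∀ {g x y} → x ≡ y → g ∣ˢ x → g ∣ˢ y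
∣-resp {g} = subst (g ∣ˢ_)

∣-≡-mod : ∀ {g x y} → g ∣ˢ x - y → g ∣ˢ x → g ∣ˢ y
∣-≡-mod {g} {x} {y} g∣x-y g∣x = ∣-resp (x-[x-y]≡y x y) (∣m∣n⇒∣m-n g∣x g∣x-y)
  where
  x-[x-y]≡y : ∀ x y → x - (x - y) ≡ y
  x-[x-y]≡y = solve-∀

1∣ : ∀ x → + 1 ∣ˢ x
1∣ x = ∣ᵤ⇒∣ (ℕ.1∣ _)

0∣ : ∀ g → g ∣ˢ + 0
0∣ g = divides (+ 0) (sym (ℤ.*-zeroˡ g))

s∣s^suc : ∀ s k → s ∣ˢ s ^ suc k
s∣s^suc s k = ∣m⇒∣m*n (s ^ k) ∣-refl

-- Coprimality of integers.  The library's `Coprime a b` is a statement about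
-- ∣a∣ and ∣b∣, from which a and b cannot be inferred, so it is wrapped.
infix 4 _⊥_
record _⊥_ (a b : ℤ) : Set where
  constructor mk⊥
  field coprime : Coprime a b
open _⊥_ using (coprime)

⊥-intro : ∀ {a b} → (∀ {g} → g ∣ˢ a → g ∣ˢ b → g ∣ˢ + 1) → a ⊥ b
⊥-intro common = mk⊥ λ (i∣a , i∣b) →
  ℕ.∣1⇒≡1 (∣⇒∣ᵤ (common {+ _} (∣ᵤ⇒∣ i∣a) (∣ᵤ⇒∣ i∣b)))

⊥-elim : ∀ {a b g} → a ⊥ b → g ∣ˢ a → g ∣ˢ b → g ∣ˢ + 1
⊥-elim a⊥b g∣a g∣b = ∣ᵤ⇒∣ (ℕ.∣-reflexive (coprime a⊥b (∣⇒∣ᵤ g∣a , ∣⇒∣ᵤ g∣b)))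

⊥-gcd : ∀ {a b} → gcd a b ≡ + 1 → a ⊥ b
⊥-gcd = mk⊥ ∘ ℕ.gcd≡1⇒coprime ∘ ℤ.+-injective

⊥-sym : ∀ {a b} → a ⊥ b → b ⊥ a
⊥-sym {a} {b} a⊥b = mk⊥ (coprime-sym {a} {b} (coprime a⊥b))

⊥-divisor : ∀ {g a b} → g ⊥ a → g ∣ˢ a * b → g ∣ˢ b
⊥-divisor {g} {a} {b} g⊥a g∣ab =
  ∣ᵤ⇒∣ (coprime-divisor g a b (coprime g⊥a) (∣⇒∣ᵤ g∣ab))

1-⊥ : ∀ {c} → + 1 ⊥ c
1-⊥ = ⊥-intro λ g∣1 _ → g∣1

⊥-≡-mod : ∀ {x y c} → c ∣ˢ x - y → y ⊥ c → x ⊥ c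
⊥-≡-mod c∣x-y y⊥c = ⊥-intro λ g∣x g∣c →
  ⊥-elim y⊥c (∣-≡-mod (∣-trans g∣c c∣x-y) g∣x) g∣c

⊥-∣ : ∀ {a b c} → c ∣ˢ a → a ⊥ b → c ⊥ b
⊥-∣ c∣a a⊥b = ⊥-intro λ g∣c g∣b → ⊥-elim a⊥b (∣-trans g∣c c∣a) g∣b

⊥-* : ∀ {a b c} → a ⊥ c → b ⊥ c → a * b ⊥ c
⊥-* a⊥c b⊥c = ⊥-intro λ g∣ab g∣c →
  ⊥-elim b⊥c (⊥-divisor (⊥-∣ g∣c (⊥-sym a⊥c)) g∣ab) g∣c

⊥-^ : ∀ {a c} k → a ⊥ c → a ^ k ⊥ c
⊥-^ zero    a⊥c = 1-⊥
⊥-^ (suc k) a⊥c = ⊥-* a⊥c (⊥-^ k a⊥c)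

⊥-neg : ∀ {a c} → a ⊥ c → - a ⊥ c
⊥-neg {a} a⊥c =
  mk⊥ (subst (λ t → ℕ.Coprime t _) (sym (ℤ.∣-i∣≡∣i∣ a)) (coprime a⊥c))

∣-*-⊥ : ∀ {s w} k y → w ⊥ s → (s ^ k ∣ˢ w * y ⇔ s ^ k ∣ˢ y)
∣-*-⊥ {w = w} k y w⊥s = mk⇔ (⊥-divisor (⊥-^ k (⊥-sym w⊥s))) (∣n⇒∣m*n w)

∣-*-cancel : ∀ s k z .{{_ : NonZero s}} → (s ^ suc k ∣ˢ s * z ⇔ s ^ k ∣ˢ z)
∣-*-cancel s k z = mk⇔ (*-cancelˡ-∣ s) (*-monoʳ-∣ s)

G-unique : ∀ {p q} (u : ℕ → ℤ) → u 0 ≡ + 0 → u 1 ≡ + 1 →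
           (∀ n → u (suc (suc n)) ≡ p * u (suc n) + q * u n) →
           ∀ n → G p q n ≡ u n
G-unique u u₀ u₁ rec zero          = sym u₀
G-unique u u₀ u₁ rec (suc zero)    = sym u₁
G-unique {p} {q} u u₀ u₁ rec (suc (suc n)) =
  trans (cong₂ (λ x y → p * x + q * y) (G-unique u u₀ u₁ rec (suc n))
                                       (G-unique u u₀ u₁ rec n))
        (sym (rec n))

G-rescale : ∀ c p q n → G (c * p) (c * c * q) n ≡ c ^ (n ∸ 1) * G p q n
G-rescale c p q = G-unique (λ n → c ^ (n ∸ 1) * G p q n) refl (ℤ.*-identityˡ (+ 1)) rec
  where
  rec : ∀ n → c ^ suc n * G p q (suc (suc n))
            ≡ c * p * (c ^ n * G p q (suc n)) + c * c * q * (c ^ (n ∸ 1) * G p q n)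
  rec zero    = initial c p q
    where
    initial : ∀ c p q → c * + 1 * (p * + 1 + q * + 0)
                        ≡ c * p * (+ 1 * + 1) + c * c * q * (+ 1 * + 0)
    initial = solve-∀
  rec (suc n) = step c p q (c ^ n) (G p q (suc (suc n))) (G p q (suc n))
    where
    step : ∀ c p q t x y → c * (c * t) * (p * x + q * y)
                           ≡ c * p * (c * t * x) + c * c * q * (t * y)
    step = solve-∀

-- Elements ⟨ a , b ⟩ = a + b√d of ℤ[√d]; the ring structure depends on d.
record ℤ√ : Set where
  constructor ⟨_,_⟩
  field re im : ℤ
open ℤ√ using (re; im)

module Quadratic (d : ℤ) where

  infixl 7 _·_
  _·_ : ℤ√ → ℤ√ → ℤ√
  ⟨ a , b ⟩ · ⟨ x , y ⟩ = ⟨ a * x + d * (b * y) , a * y + b * x ⟩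

  one : ℤ√
  one = ⟨ + 1 , + 0 ⟩

  infixr 8 _^√_
  _^√_ : ℤ√ → ℕ → ℤ√
  α ^√ zero  = one
  α ^√ suc n = α · α ^√ n

  norm : ℤ√ → ℤ
  norm ⟨ a , b ⟩ = a * a - d * (b * b)

  ·-identityˡ : ∀ α → one · α ≡ α
  ·-identityˡ ⟨ a , b ⟩ = cong₂ ⟨_,_⟩ (re-id d a b) (im-id a b)
    where
    re-id : ∀ d a b → + 1 * a + d * (+ 0 * b) ≡ a
    re-id = solve-∀
    im-id : ∀ a b → + 1 * b + + 0 * a ≡ b
    im-id = solve-∀

  ·-assoc : ∀ α β γ → α · β · γ ≡ α · (β · γ)
  ·-assoc ⟨ a , b ⟩ ⟨ c , e ⟩ ⟨ f , g ⟩ =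
    cong₂ ⟨_,_⟩ (re-assoc d a b c e f g) (im-assoc d a b c e f g)
    where
    re-assoc : ∀ d a b c e f g →
      (a * c + d * (b * e)) * f + d * ((a * e + b * c) * g)
        ≡ a * (c * f + d * (e * g)) + d * (b * (c * g + e * f))
    re-assoc = solve-∀
    im-assoc : ∀ d a b c e f g →
      (a * c + d * (b * e)) * g + (a * e + b * c) * f
        ≡ a * (c * g + e * f) + b * (c * f + d * (e * g))
    im-assoc = solve-∀

  ^√-+ : ∀ α j k → α ^√ (j ℕ.+ k) ≡ α ^√ j · α ^√ k
  ^√-+ α zero    k = sym (·-identityˡ (α ^√ k))
  ^√-+ α (suc j) k = begin
    α · α ^√ (j ℕ.+ k)      ≡⟨ cong (α ·_) (^√-+ α j k) ⟩
    α · (α ^√ j · α ^√ k)   ≡⟨ sym (·-assoc α (α ^√ j) (α ^√ k)) ⟩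
    α · α ^√ j · α ^√ k     ∎
    where open ≡-Reasoning

  ^√-* : ∀ α j n → α ^√ (j ℕ.* n) ≡ (α ^√ n) ^√ j
  ^√-* α zero    n = refl
  ^√-* α (suc j) n = trans (^√-+ α n (j ℕ.* n)) (cong (α ^√ n ·_) (^√-* α j n))

  norm-· : ∀ α β → norm (α · β) ≡ norm α * norm β
  norm-· ⟨ a , b ⟩ ⟨ x , y ⟩ = identity d a b x y
    where
    identity : ∀ d a b x y →
      (a * x + d * (b * y)) * (a * x + d * (b * y)) - d * ((a * y + b * x) * (a * y + b * x))
        ≡ (a * a - d * (b * b)) * (x * x - d * (y * y))
    identity = solve-∀

  norm-^√ : ∀ α n → norm (α ^√ n) ≡ norm α ^ n
  norm-^√ α zero    = norm-one d
    where
    norm-one : ∀ d → + 1 * + 1 - d * (+ 0 * + 0) ≡ + 1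
    norm-one = solve-∀
  norm-^√ α (suc n) = trans (norm-· α (α ^√ n)) (cong (norm α *_) (norm-^√ α n))

  module Binomial {D : ℤ} (D∣d : D ∣ˢ d) where

    re-^√ : ∀ a n → D ∣ˢ re (⟨ a , + 1 ⟩ ^√ n) - a ^ n
    re-^√ a zero    = 0∣ D
    re-^√ a (suc n) =
      ∣-resp (sym (identity a (re αⁿ) (d * (+ 1 * im αⁿ)) (a ^ n)))
             (∣m∣n⇒∣m+n (∣n⇒∣m*n a (re-^√ a n)) (∣m⇒∣m*n _ D∣d))
      where
      αⁿ = ⟨ a , + 1 ⟩ ^√ n
      identity : ∀ a x e t → a * x + e - a * t ≡ a * (x - t) + e
      identity = solve-∀

    im-^√ : ∀ a n → D ∣ˢ im (⟨ a , + 1 ⟩ ^√ suc n) - + suc n * a ^ n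
    im-^√ a zero    = ∣-resp (sym (identity a)) (0∣ D)
      where
      identity : ∀ a → a * + 0 + + 1 * + 1 - + 1 * + 1 ≡ + 0
      identity = solve-∀
    im-^√ a (suc n) =
      ∣-resp (sym (identity a (im αⁿ⁺¹) (re αⁿ⁺¹) (+ suc n) (a ^ n)))
             (∣m∣n⇒∣m+n (∣n⇒∣m*n a (im-^√ a n)) (re-^√ a (suc n)))
      where
      αⁿ⁺¹ = ⟨ a , + 1 ⟩ ^√ suc n
      identity : ∀ a y x k t → a * y + + 1 * x - (+ 1 + k) * (a * t)
                               ≡ a * (y - k * t) + (x - a * t)
      identity = solve-∀

-- x + y√(d·b²) ↦ x + (b·y)√d embeds ℤ[√(d·b²)] into ℤ[√d] as a ring; hence
-- (a + b√d)^n is the image of (a + √(d·b²))^n, and its √d-coefficient is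
-- divisible by b.
^√-scale : ∀ d a b n →
  Quadratic._^√_ d ⟨ a , b ⟩ n
    ≡ ⟨ re (Quadratic._^√_ (d * (b * b)) ⟨ a , + 1 ⟩ n) ,
        b * im (Quadratic._^√_ (d * (b * b)) ⟨ a , + 1 ⟩ n) ⟩
^√-scale d a b zero    = cong ⟨ + 1 ,_⟩ (sym (ℤ.*-zeroʳ b))
^√-scale d a b (suc n) = begin
  ⟨ a , b ⟩ · αⁿ
    ≡⟨ cong (⟨ a , b ⟩ ·_) (^√-scale d a b n) ⟩
  ⟨ a , b ⟩ · ⟨ re βⁿ , b * im βⁿ ⟩
    ≡⟨ cong₂ ⟨_,_⟩ (re-eq d a b (re βⁿ) (im βⁿ)) (im-eq a b (re βⁿ) (im βⁿ)) ⟩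
  ⟨ re (⟨ a , + 1 ⟩ ·′ βⁿ) , b * im (⟨ a , + 1 ⟩ ·′ βⁿ) ⟩
    ∎
  where
  open ≡-Reasoning
  open Quadratic d using (_·_; _^√_)
  open Quadratic (d * (b * b)) using () renaming (_·_ to _·′_; _^√_ to _^√′_)
  αⁿ = ⟨ a , b ⟩ ^√ n
  βⁿ = ⟨ a , + 1 ⟩ ^√′ n
  re-eq : ∀ d a b x y → a * x + d * (b * (b * y)) ≡ a * x + d * (b * b) * (+ 1 * y)
  re-eq = solve-∀
  im-eq : ∀ a b x y → a * (b * y) + b * x ≡ b * (a * y + + 1 * x)
  im-eq = solve-∀

≡-mod-s² : ∀ s x y → s * s ∣ˢ x - s * y → Σ ℤ λ w → s ∣ˢ w - y × x ≡ s * w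
≡-mod-s² s x y (divides c x-sy≡cs²) =
  y + c * s , ∣-resp (sym (w-y≡cs y c s)) (∣n⇒∣m*n c ∣-refl) , x≡sw
  where
  open ≡-Reasoning
  w-y≡cs : ∀ y c s → y + c * s - y ≡ c * s
  w-y≡cs = solve-∀
  x≡sw : x ≡ s * (y + c * s)
  x≡sw = begin
    x                        ≡⟨ split x (s * y) ⟩
    x - s * y + s * y        ≡⟨ cong (_+ s * y) x-sy≡cs² ⟩
    c * (s * s) + s * y      ≡⟨ regroup s y c ⟩
    s * (y + c * s)          ∎
    where
    split : ∀ x t → x ≡ x - t + t
    split = solve-∀
    regroup : ∀ s y c → c * (s * s) + s * y ≡ s * (y + c * s)
    regroup = solve-∀

module EvenCase (m q : ℤ) (r : ℕ) (m⊥q : m ⊥ q)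
                (s²∣d : + suc r * + suc r ∣ˢ m * m + q) where

  S : ℕ
  S = suc r

  s : ℤ
  s = + S

  d : ℤ
  d = m * m + q

  open Quadratic d

  α : ℤ√
  α = ⟨ m , + 1 ⟩

  X Y : ℕ → ℤ
  X n = re (α ^√ n)
  Y n = im (α ^√ n)

  -- G(2m, q, n) is the √d-coefficient of α^n, because α² = 2m·α + q.
  G≡Y : ∀ n → G (+ 2 * m) q n ≡ Y n
  G≡Y = G-unique Y refl (Y₁ m) λ n → Y-rec m q (X n) (Y n)
    where
    Y₁ : ∀ m → m * + 0 + + 1 * + 1 ≡ + 1
    Y₁ = solve-∀
    Y-rec : ∀ m q x y →
      m * (m * y + + 1 * x) + + 1 * (m * x + (m * m + q) * (+ 1 * y))
        ≡ + 2 * m * (m * y + + 1 * x) + q * y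
    Y-rec = solve-∀

  s∣d : s ∣ˢ d
  s∣d = ∣-trans (∣m⇒∣m*n s ∣-refl) s²∣d

  -- d ≡ q (mod m) and d ≡ m² (mod q), so d, and with it s, is coprime to m and q.
  s⊥m : s ⊥ m
  s⊥m = ⊥-∣ s∣d (⊥-≡-mod (∣-resp (sym (d-q m q)) (∣m⇒∣m*n m ∣-refl)) (⊥-sym m⊥q))
    where
    d-q : ∀ m q → m * m + q - q ≡ m * m
    d-q = solve-∀

  s⊥q : s ⊥ q
  s⊥q = ⊥-∣ s∣d (⊥-≡-mod (∣-resp (sym (d-m² m q)) ∣-refl) (⊥-* m⊥q m⊥q))
    where
    d-m² : ∀ m q → m * m + q - m * m ≡ q
    d-m² = solve-∀

  -- The norm identity X_n² - d·Y_n² = (-q)^n makes every X_n coprime to s.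
  X⊥s : ∀ n → X n ⊥ s
  X⊥s n = ⊥-∣ (∣m⇒∣m*n (X n) ∣-refl) (⊥-≡-mod s∣X²-norm norm⊥s)
    where
    norm-α : ∀ m q → m * m - (m * m + q) * (+ 1 * + 1) ≡ - q
    norm-α = solve-∀
    norm⊥s : norm (α ^√ n) ⊥ s
    norm⊥s = subst (_⊥ s) (sym (trans (norm-^√ α n) (cong (_^ n) (norm-α m q))))
                   (⊥-^ n (⊥-neg (⊥-sym s⊥q)))
    X²-norm : ∀ d x y → x * x - (x * x - d * (y * y)) ≡ d * (y * y)
    X²-norm = solve-∀
    s∣X²-norm : s ∣ˢ X n * X n - norm (α ^√ n)
    s∣X²-norm = ∣-resp (sym (X²-norm d (X n) (Y n))) (∣m⇒∣m*n (Y n * Y n) s∣d)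

  -- Y_{j+1} ≡ (j+1)·m^j (mod s) and m ⊥ s, so s ∣ Y_n forces s ∣ n.
  s∣Y⇒s∣n : ∀ n → s ∣ˢ Y n → s ∣ˢ + n
  s∣Y⇒s∣n zero    _     = 0∣ s
  s∣Y⇒s∣n (suc j) s∣Y =
    ⊥-divisor s⊥mʲ (∣-resp (ℤ.*-comm (+ suc j) (m ^ j)) s∣[j+1]mʲ)
    where
    s⊥mʲ : s ⊥ m ^ j
    s⊥mʲ = ⊥-sym (⊥-^ j (⊥-sym s⊥m))
    s∣[j+1]mʲ : s ∣ˢ + suc j * m ^ j
    s∣[j+1]mʲ = ∣-≡-mod (Binomial.im-^√ s∣d m j) s∣Y

  -- α^{sn} = (X_n + Y_n√d)^s, whose √d-coefficient is Y_n·W_n where W_n is the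
  -- √e_n-coefficient of (X_n + √e_n)^s, e_n = d·Y_n² (see ^√-scale).
  W : ℕ → ℤ
  W n = im (Quadratic._^√_ (d * (Y n * Y n)) ⟨ X n , + 1 ⟩ S)

  Y-sn≡YW : ∀ n → Y (S ℕ.* n) ≡ Y n * W n
  Y-sn≡YW n = trans (cong im (^√-* α S n)) (cong im (^√-scale d (X n) (Y n) S))

  -- W_n ≡ s·X_n^{s-1} (mod s²): the binomial congruence in ℤ[√e_n], as s² ∣ e_n.
  W≡sXʳ : ∀ n → s * s ∣ˢ W n - s * X n ^ r
  W≡sXʳ n =
    Quadratic.Binomial.im-^√ (d * (Y n * Y n)) (∣m⇒∣m*n (Y n * Y n) s²∣d) (X n) r

  -- Lifting: Y_{s·n} = s·w·Y_n with w ≡ X_n^{s-1} (mod s), hence w ⊥ s.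
  Y-lift : ∀ n → Σ ℤ λ w → w ⊥ s × Y (S ℕ.* n) ≡ s * (w * Y n)
  Y-lift n = lift (≡-mod-s² s (W n) (X n ^ r) (W≡sXʳ n))
    where
    lift : (Σ ℤ λ w → s ∣ˢ w - X n ^ r × W n ≡ s * w) →
           Σ ℤ λ w → w ⊥ s × Y (S ℕ.* n) ≡ s * (w * Y n)
    lift (w , s∣w-Xʳ , W≡sw) = w , ⊥-≡-mod s∣w-Xʳ (⊥-^ r (X⊥s n)) , Y-sn≡swY
      where
      open ≡-Reasoning
      rotate : ∀ y s w → y * (s * w) ≡ s * (w * y)
      rotate = solve-∀
      Y-sn≡swY : Y (S ℕ.* n) ≡ s * (w * Y n)
      Y-sn≡swY = begin
        Y (S ℕ.* n)     ≡⟨ Y-sn≡YW n ⟩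
        Y n * W n       ≡⟨ cong (Y n *_) W≡sw ⟩
        Y n * (s * w)   ≡⟨ rotate (Y n) s w ⟩
        s * (w * Y n)   ∎

  lift-⇔ : ∀ k n → (s ^ k ∣ˢ + n ⇔ s ^ k ∣ˢ Y n) →
           (s ^ suc k ∣ˢ + (S ℕ.* n) ⇔ s ^ suc k ∣ˢ Y (S ℕ.* n))
  lift-⇔ k n hyp = chain (Y-lift n)
    where
    open EquationalReasoning
    chain : (Σ ℤ λ w → w ⊥ s × Y (S ℕ.* n) ≡ s * (w * Y n)) →
            (s ^ suc k ∣ˢ + (S ℕ.* n) ⇔ s ^ suc k ∣ˢ Y (S ℕ.* n))
    chain (w , w⊥s , Y-sn≡swY) = begin
      s ^ suc k ∣ˢ + (S ℕ.* n)        ≡⟨ cong (s ^ suc k ∣ˢ_) (ℤ.pos-* S n) ⟩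
      s ^ suc k ∣ˢ s * + n            ∼⟨ ∣-*-cancel s k (+ n) ⟩
      s ^ k ∣ˢ + n                    ∼⟨ hyp ⟩
      s ^ k ∣ˢ Y n                    ∼⟨ ⇔-sym (∣-*-⊥ k (Y n) w⊥s) ⟩
      s ^ k ∣ˢ w * Y n                ∼⟨ ⇔-sym (∣-*-cancel s k (w * Y n)) ⟩
      s ^ suc k ∣ˢ s * (w * Y n)      ≡⟨ cong (s ^ suc k ∣ˢ_) (sym Y-sn≡swY) ⟩
      s ^ suc k ∣ˢ Y (S ℕ.* n)        ∎

  -- s^k ∣ n ⇔ s^k ∣ Y_n, by induction on k: for k ≥ 1 either side forces
  -- s ∣ n, and lift-⇔ applies to n = s·n′.
  ∣n⇔∣Y : ∀ k n → (s ^ k ∣ˢ + n ⇔ s ^ k ∣ˢ Y n)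
  ∣n⇔∣Y zero    n = mk⇔ (λ _ → 1∣ (Y n)) (λ _ → 1∣ (+ n))
  ∣n⇔∣Y (suc k) n = mk⇔
    (λ h → Equivalence.to   (at-multiple (∣-trans (s∣s^suc s k) h)) h)
    (λ h → Equivalence.from (at-multiple (s∣Y⇒s∣n n (∣-trans (s∣s^suc s k) h))) h)
    where
    at-multiple : s ∣ˢ + n → (s ^ suc k ∣ˢ + n ⇔ s ^ suc k ∣ˢ Y n)
    at-multiple s∣n = subst (λ n → s ^ suc k ∣ˢ + n ⇔ s ^ suc k ∣ˢ Y n)
                            (sym (ℕ.m∣n⇒n≡m*quotient (∣⇒∣ᵤ s∣n)))
                            (lift-⇔ k _ (∣n⇔∣Y k _))

  even-case : ∀ k n → (s ^ k ∣ˢ + n ⇔ s ^ k ∣ˢ G (+ 2 * m) q n)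
  even-case k n = subst (λ g → s ^ k ∣ˢ + n ⇔ s ^ k ∣ˢ g) (sym (G≡Y n)) (∣n⇔∣Y k n)

-- The odd case p = 2m + 1 reduces to the even case for (2p, 4q): here
-- G(2p, 4q, n) = 2^(n-1)·G(p, q, n), and s ⊥ 2 because s² divides the odd
-- number p² + 4q.
odd-case : ∀ (p q : ℤ) (r : ℕ) → (∃[ m ] p ≡ + 2 * m + + 1) → p ⊥ q →
           + suc r * + suc r ∣ˢ p * p + + 4 * q →
           ∀ k n → ((+ suc r) ^ k ∣ˢ + n ⇔ (+ suc r) ^ k ∣ˢ G p q n)
odd-case p q r (m , p≡2m+1) p⊥q s²∣d k n = begin
  s ^ k ∣ˢ + n                          ∼⟨ EvenCase.even-case p (+ 4 * q) r p⊥4q s²∣d k n ⟩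
  s ^ k ∣ˢ G (+ 2 * p) (+ 4 * q) n      ≡⟨ cong (s ^ k ∣ˢ_) (G-rescale (+ 2) p q n) ⟩
  s ^ k ∣ˢ (+ 2) ^ (n ∸ 1) * G p q n    ∼⟨ ∣-*-⊥ k (G p q n) (⊥-^ (n ∸ 1) 2⊥s) ⟩
  s ^ k ∣ˢ G p q n                      ∎
  where
  open EquationalReasoning
  s = + suc r
  p-1≡2m : p - + 1 ≡ + 2 * m
  p-1≡2m = trans (cong (_- + 1) p≡2m+1) (cancel m)
    where
    cancel : ∀ m → + 2 * m + + 1 - + 1 ≡ + 2 * m
    cancel = solve-∀
  p⊥2 : p ⊥ + 2
  p⊥2 = ⊥-≡-mod (∣-resp (sym p-1≡2m) (∣m⇒∣m*n m ∣-refl)) 1-⊥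
  p⊥4q : p ⊥ + 4 * q
  p⊥4q = ⊥-sym (⊥-* (⊥-* (⊥-sym p⊥2) (⊥-sym p⊥2)) (⊥-sym p⊥q))
  d⊥2 : p * p + + 4 * q ⊥ + 2
  d⊥2 = ⊥-≡-mod (∣-resp (sym (d-p² p q)) (∣m⇒∣m*n (+ 2 * q) ∣-refl)) (⊥-* p⊥2 p⊥2)
    where
    d-p² : ∀ p q → p * p + + 4 * q - p * p ≡ + 2 * (+ 2 * q)
    d-p² = solve-∀
  2⊥s : + 2 ⊥ s
  2⊥s = ⊥-sym (⊥-∣ (∣-trans (∣m⇒∣m*n s ∣-refl) s²∣d) d⊥2)

⇔-unsigned : ∀ {a b c} → (a ∣ˢ b ⇔ a ∣ˢ c) → (a ∣ b ⇔ a ∣ c)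
⇔-unsigned a∣b⇔a∣c =
  mk⇔ (∣⇒∣ᵤ ∘ Equivalence.to a∣b⇔a∣c ∘ ∣ᵤ⇒∣)
      (∣⇒∣ᵤ ∘ Equivalence.from a∣b⇔a∣c ∘ ∣ᵤ⇒∣)

-- A positive s is 1 + r; the two alternatives are the odd and the even case.

corollary1p3 : (p q s : ℤ) →
    p * p + (+ 4) * q ≢ + 0 →
    s > + 0 →
    ((∃[ m ] p ≡ (+ 2) * m + (+ 1)) × gcd p q ≡ + 1 × (s * s) ∣ (p * p + (+ 4) * q))
      ⊎ (∃[ m ] (p ≡ (+ 2) * m × gcd m q ≡ + 1 × (s * s) ∣ (m * m + q))) →
    (k n : ℕ) → ((s ^ k) ∣ (+ n)) ⇔ ((s ^ k) ∣ G p q n)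
corollary1p3 p q (+ zero)  _ (+<+ ()) _ _ _
corollary1p3 p q -[1+ _ ] _ () _ _ _
corollary1p3 p q (+ suc r) _ _ (inj₁ (p-odd , gcd≡1 , s²∣d)) k n =
  ⇔-unsigned (odd-case p q r p-odd (⊥-gcd gcd≡1) (∣ᵤ⇒∣ s²∣d) k n)
corollary1p3 p q (+ suc r) _ _ (inj₂ (m , refl , gcd≡1 , s²∣d)) k n =
  ⇔-unsigned (EvenCase.even-case m q r (⊥-gcd gcd≡1) (∣ᵤ⇒∣ s²∣d) k n)
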